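{- Let $G$ be an interval graph with an intersection model as in the context, let $1\le i\le n$, let $v_x\in N_G(v_i)$ and $v_y\in N_G(v_x)$. Then $$\tilde N_{i}(v_x)\cup \tilde N_{i}(v_y)\subseteq \tilde N_{i}(p(v_i))\cup \tilde N_{i}(p(p(v_i))).$$
   Context: An interval graph $G$ with $V(G)=\{v_1,\dots,v_n\}$ is given by an intersection model: each vertex $v$ corresponds to a closed interval $a(v)=[\ell(v),r(v)]$ on the real line, two vertices being adjacent iff their intervals intersect; all $2n$ endpoints are distinct and vertices are indexed so that $\ell(v_1)<\dots<\ell(v_n)$. $N_G(v)$ denotes the set of neighbours of $v$. The partner $p(v)$ of $v$ is the neighbour of $v$ whose interval has the largest right endpoint among all neighbours of $v$. For fixed $i$, let $v_{i^*}$ be the vertex whose left endpoint is the first left endpoint encountered moving rightwards from $r(v_i)$, so $\{v_{i^*},v_{i^*+1},\dots,v_n\}$ is the set of vertices $v_j$ with $\ell(v_j)>r(v_i)$. For a vertex $u$, $\tilde N_i(u)$ denotes the set of vertices adjacent to $u$ in the induced subgraph $G[\{u\}\cup\{v_j : \ell(v_j)>r(v_i)\}]$. -}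

module Defs where

open import Data.Nat using (ℕ; _≤_; _<_)
open import Data.Fin using (Fin)
open import Data.Product using (_×_)
open import Relation.Nullary using (¬_)
open import Relation.Binary.PropositionalEquality using (_≡_; _≢_)

-- An intersection model of an interval graph on vertices v_1..v_n
-- (vertex v_{k+1} is represented by k : Fin n).  Endpoints are taken in ℕ:
-- only the relative order of the 2n distinct endpoints matters.
record IntervalModel (n : ℕ) : Set where
  field
    ℓ : Fin n → ℕ
    r : Fin n → ℕ
    ℓ<r       : ∀ v → ℓ v < r v
    ℓ-inj     : ∀ u v → ℓ u ≡ ℓ v → u ≡ v
    r-inj     : ∀ u v → r u ≡ r v → u ≡ v
    ℓ≢r       : ∀ u v → ℓ u ≢ r v
    ℓ-sorted  : ∀ u v → Data.Fin._<_ u v → ℓ u < ℓ v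

open IntervalModel public

module _ {n : ℕ} (M : IntervalModel n) where

  Adj : Fin n → Fin n → Set
  Adj u v = u ≢ v × (ℓ M u ≤ r M v × ℓ M v ≤ r M u)

  IsPartner : Fin n → Fin n → Set
  IsPartner v w = Adj v w × (∀ u → Adj v u → r M u ≤ r M w)

  -- w ∈ Ñ_i(u): w adjacent to u in G[{u} ∪ {v_j : ℓ(v_j) > r(v_i)}]
  Ñ : Fin n → Fin n → Fin n → Set
  Ñ i u w = Adj u w × r M i < ℓ M w

-- Every w in question starts after r(v_i), hence after ℓ(p₁) ≤ r(v_i); so w is
-- a neighbour of an interval u with ℓ(u) < ℓ(w) as soon as ℓ(w) ≤ r(u).  For
-- x this holds with u = p₁ because r(x) ≤ r(p₁).  For y either ℓ(w) ≤ r(p₁)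
-- again, or y reaches past r(p₁); then y is a neighbour of p₁ (it meets x, and
-- r(x) ≤ r(p₁)), so r(y) ≤ r(p₂), while ℓ(p₂) ≤ r(p₁) < ℓ(w): take u = p₂.
module Submission where

open import Defs
open import Data.Nat using (ℕ; _<_; _≤_; _≤?_)
open import Data.Nat.Properties using (<-irrefl; ≤-trans; <⇒≤; <-≤-trans; ≤-<-trans; ≰⇒>)
open import Data.Fin using (Fin)
open import Data.Sum using (_⊎_; inj₁; inj₂)
open import Data.Product using (_,_; proj₂)
open import Relation.Binary.PropositionalEquality using (_≢_; refl)
open import Relation.Nullary using (yes; no)

module _ {n : ℕ} (M : IntervalModel n) where

  ≢-if-r< : ∀ {u v} → r M u < r M v → u ≢ v
  ≢-if-r< r<r refl = <-irrefl refl r<r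

  ≢-if-ℓ< : ∀ {u v} → ℓ M u < ℓ M v → u ≢ v
  ≢-if-ℓ< ℓ<ℓ refl = <-irrefl refl ℓ<ℓ

  Adj-if-starts-inside : ∀ {u w} → ℓ M u < ℓ M w → ℓ M w ≤ r M u → Adj M u w
  Adj-if-starts-inside {w = w} ℓu<ℓw ℓw≤ru =
    ≢-if-ℓ< ℓu<ℓw , <⇒≤ (<-≤-trans ℓu<ℓw (<⇒≤ (ℓ<r M w))) , ℓw≤ru

  Ñ-if-starts-inside : ∀ {i u w} → r M i < ℓ M w →
    ℓ M u < ℓ M w → ℓ M w ≤ r M u → Ñ M i u w
  Ñ-if-starts-inside ri<ℓw ℓu<ℓw ℓw≤ru = Adj-if-starts-inside ℓu<ℓw ℓw≤ru , ri<ℓw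

  r≤r-partner : ∀ {v p u} → IsPartner M v p → Adj M v u → r M u ≤ r M p
  r≤r-partner (_ , maximal) = maximal _

lemma1 : ∀ {n} (M : IntervalModel n) (i x y p₁ p₂ : Fin n) →
    Adj M i x → Adj M x y →
    IsPartner M i p₁ → IsPartner M p₁ p₂ →
    ∀ w → (Ñ M i x w ⊎ Ñ M i y w) → (Ñ M i p₁ w ⊎ Ñ M i p₂ w)
lemma1 M i x y p₁ p₂ i~x x~y partner₁@((_ , _ , ℓp₁≤ri) , _) partner₂@((_ , _ , ℓp₂≤rp₁) , _) w
  = cases
  where
  in-p₁ : r M i < ℓ M w → ℓ M w ≤ r M p₁ → Ñ M i p₁ w ⊎ Ñ M i p₂ w
  in-p₁ ri<ℓw ℓw≤rp₁ = inj₁ (Ñ-if-starts-inside M ri<ℓw (≤-<-trans ℓp₁≤ri ri<ℓw) ℓw≤rp₁)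

  rx≤rp₁ : r M x ≤ r M p₁
  rx≤rp₁ = r≤r-partner M partner₁ i~x

  cases : Ñ M i x w ⊎ Ñ M i y w → Ñ M i p₁ w ⊎ Ñ M i p₂ w
  cases (inj₁ ((_ , _ , ℓw≤rx) , ri<ℓw)) = in-p₁ ri<ℓw (≤-trans ℓw≤rx rx≤rp₁)
  cases (inj₂ ((_ , _ , ℓw≤ry) , ri<ℓw)) with ℓ M w ≤? r M p₁
  ... | yes ℓw≤rp₁ = in-p₁ ri<ℓw ℓw≤rp₁
  ... | no ℓw≰rp₁ = inj₂ (Ñ-if-starts-inside M ri<ℓw (≤-<-trans ℓp₂≤rp₁ rp₁<ℓw) (≤-trans ℓw≤ry ry≤rp₂))
    where
    rp₁<ℓw : r M p₁ < ℓ M w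
    rp₁<ℓw = ≰⇒> ℓw≰rp₁
    p₁~y : Adj M p₁ y
    p₁~y = ≢-if-r< M (<-≤-trans rp₁<ℓw ℓw≤ry)
         , <⇒≤ (≤-<-trans ℓp₁≤ri (<-≤-trans ri<ℓw ℓw≤ry))
         , ≤-trans (proj₂ (proj₂ x~y)) rx≤rp₁
    ry≤rp₂ : r M y ≤ r M p₂
    ry≤rp₂ = r≤r-partner M partner₂ p₁~y
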